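{- Let $T_0$ be a theory and let $T=\{\varphi : T_0\models\varphi\}$. If $T_0$ is generic, then $T$ is generic; and if $T_0$ is closed generic, then $T$ is closed generic.
   Context: Fix a nonempty set of symbols called propositional atoms and a symbol $\mathrm{K}$ which is not a propositional atom. Formulas are defined recursively: every propositional atom is a formula; if $\varphi,\psi$ are formulas then so are $\neg\varphi$, $(\varphi\wedge\psi)$, $(\varphi\vee\psi)$, $(\varphi\rightarrow\psi)$; if $\varphi$ is a formula then so is $\mathrm{K}(\varphi)$. A formula is basic if it is a propositional atom or of the form $\mathrm{K}\varphi$. A theory is a set of formulas. A model is a function assigning a truth value to every basic formula; truth $\mathscr M\models\varphi$ of an arbitrary formula is defined from the values of basic formulas by the classical truth tables (formulas $\mathrm{K}\varphi$ are treated like atoms). $\mathscr M\models T$ means $\mathscr M\models\varphi$ for all $\varphi\in T$; $T\models\varphi$ means every model of $T$ satisfies $\varphi$. A theory $T$ is closed if $\varphi\in T$ implies $\mathrm{K}\varphi\in T$. For a theory $T$ and a set $S$ of propositional atoms, $\mathscr M_{T,S}$ is the model with $\mathscr M_{T,S}\models p$ iff $p\in S$ for atoms $p$, and $\mathscr M_{T,S}\models\mathrm{K}\varphi$ iff $T\models\varphi$. A theory $T$ is generic if for every set $S$ of propositional atoms and every theory $T'\supseteq T$, $\mathscr M_{T',S}\models T$; $T$ is closed generic if for every set $S$ of propositional atoms and every closed theory $T'\supseteq T$, $\mathscr M_{T',S}\models T$. -}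

module Defs where

open import Data.Bool using (Bool; true; false; not; _∧_; _∨_; if_then_else_)
open import Relation.Binary.PropositionalEquality using (_≡_)
open import Data.Product using (_×_)
open import Function.Bundles using (_⇔_)

data Formula (A : Set) : Set where
  atom : A → Formula A
  ¬′_  : Formula A → Formula A
  _∧′_ : Formula A → Formula A → Formula A
  _∨′_ : Formula A → Formula A → Formula A
  _⇒′_ : Formula A → Formula A → Formula A
  K    : Formula A → Formula A

-- A model assigns a truth value to every basic formula.  The basic formulas
-- are exactly the atoms  atom p  and the formulas  K φ , so a model is given
-- by its values on atoms and its values on K-formulas.
record Model (A : Set) : Set where
  field
    atomVal : A → Bool
    kVal    : Formula A → Bool  -- value of the basic formula  K φ
open Model public

eval : {A : Set} → Model A → Formula A → Bool
eval M (atom p)  = atomVal M p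
eval M (¬′ φ)    = not (eval M φ)
eval M (φ ∧′ ψ)  = eval M φ ∧ eval M ψ
eval M (φ ∨′ ψ)  = eval M φ ∨ eval M ψ
eval M (φ ⇒′ ψ)  = if eval M φ then eval M ψ else true
eval M (K φ)     = kVal M φ

_⊨_ : {A : Set} → Model A → Formula A → Set
M ⊨ φ = eval M φ ≡ true

Theory : Set → Set₁
Theory A = Formula A → Set

AtomSet : Set → Set₁
AtomSet A = A → Set

_⊨ᵀ_ : {A : Set} → Model A → Theory A → Set
M ⊨ᵀ T = ∀ φ → T φ → M ⊨ φ

_⊩_ : {A : Set} → Theory A → Formula A → Set
_⊩_ {A} T φ = ∀ (M : Model A) → M ⊨ᵀ T → M ⊨ φ

_⊆ᵀ_ : {A : Set} → Theory A → Theory A → Set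
T ⊆ᵀ T′ = ∀ φ → T φ → T′ φ

Closed : {A : Set} → Theory A → Set
Closed T = ∀ φ → T φ → T (K φ)

-- M is the model  M_{T,S} : it is characterised by
--   M ⊨ p  iff  p ∈ S   for atoms p,   and   M ⊨ K φ  iff  T ⊨ φ.
-- (Since T ⊨ φ is not decidable constructively, we describe M_{T,S} by this
-- specification, which determines a model uniquely up to extensional equality.)
IsM : {A : Set} → Theory A → AtomSet A → Model A → Set
IsM T S M = (∀ p → (atomVal M p ≡ true ⇔ S p)) × (∀ φ → (kVal M φ ≡ true ⇔ T ⊩ φ))

Generic : {A : Set} → Theory A → Set₁
Generic {A} T = ∀ (S : AtomSet A) (T′ : Theory A) → T ⊆ᵀ T′ →
  ∀ (M : Model A) → IsM T′ S M → M ⊨ᵀ T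

ClosedGeneric : {A : Set} → Theory A → Set₁
ClosedGeneric {A} T = ∀ (S : AtomSet A) (T′ : Theory A) → Closed T′ → T ⊆ᵀ T′ →
  ∀ (M : Model A) → IsM T′ S M → M ⊨ᵀ T

Cn : {A : Set} → Theory A → Theory A
Cn T₀ φ = T₀ ⊩ φ

{-# OPTIONS --safe #-}
module Submission where

open import Defs
open import Data.Product using (_×_; _,_)

-- Every T′ ⊇ Cn T₀ contains T₀, so (closed) genericity of T₀ gives
-- M_{T′,S} ⊨ T₀; and a model of T₀ satisfies every consequence of T₀.

module _ {A : Set} where

  ⊆ᵀ-trans : {T T′ T″ : Theory A} → T ⊆ᵀ T′ → T′ ⊆ᵀ T″ → T ⊆ᵀ T″
  ⊆ᵀ-trans T⊆T′ T′⊆T″ φ φ∈T = T′⊆T″ φ (T⊆T′ φ φ∈T)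

  ⊆-Cn : (T : Theory A) → T ⊆ᵀ Cn T
  ⊆-Cn T φ φ∈T M M⊨T = M⊨T φ φ∈T

  ⊨ᵀ-Cn : {M : Model A} {T : Theory A} → M ⊨ᵀ T → M ⊨ᵀ Cn T
  ⊨ᵀ-Cn {M} M⊨T φ T⊩φ = T⊩φ M M⊨T

  Generic-Cn : {T : Theory A} → Generic T → Generic (Cn T)
  Generic-Cn {T} gen S T′ Cn⊆T′ M isM =
    ⊨ᵀ-Cn (gen S T′ (⊆ᵀ-trans (⊆-Cn T) Cn⊆T′) M isM)

  ClosedGeneric-Cn : {T : Theory A} → ClosedGeneric T → ClosedGeneric (Cn T)
  ClosedGeneric-Cn {T} gen S T′ closed Cn⊆T′ M isM =
    ⊨ᵀ-Cn (gen S T′ closed (⊆ᵀ-trans (⊆-Cn T) Cn⊆T′) M isM)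

lemma17 : {A : Set} → A → (T₀ : Theory A) →
    (Generic T₀ → Generic (Cn T₀)) × (ClosedGeneric T₀ → ClosedGeneric (Cn T₀))
lemma17 _ T₀ = Generic-Cn , ClosedGeneric-Cn
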